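{- Let $\mathcal{H}$ be a hypergraph whose edge set is partitioned into matchings $\mathcal{M}_{i,j}$ ($i\in[d]$, $j\in[c]$), each with exactly $n$ edges, with orderings $\ell_{i,j}$ of $\mathcal{M}_{i,j}$, where the second index is read modulo $c$ (so $\ell_{i,c}=\ell_{i,0}$). Suppose that for some $x\in[n]$ and some positive integer $r<\Delta(\mathcal{H})$ we have $\gcd(dc,r)=d$ and $ms(\ell_{i,j},\ell_{i,j+1})\ge n-x$ for all $i\in[d]$ and $j\in[c]$. Then $cms_r(\mathcal{H})\ge rn-x$.
   Context: A hypergraph $\mathcal{H}=(V,E)$ consists of a finite vertex set and a finite set of edges, each with an associated vertex set; parallel edges are allowed. $\Delta(\mathcal{H})$ is the maximum vertex degree. $[n]=\{0,\ldots,n-1\}$. A matching is a set of edges no two of which share a vertex. An ordering of a set of $\varepsilon$ edges is a bijection onto $[\varepsilon]$. For a sequence $S=e_0,\ldots,e_{s-1}$ of edges, $\mathcal{H}(S)$ is the hypergraph with the $s$ terms of $S$ as edges (counted with multiplicity). A sequence is cyclically consecutive in an ordering $\ell$ of $\mathcal{H}$ (with $\varepsilon$ edges) if $\ell(e_i)\equiv\ell(e_0)+i\pmod{\varepsilon}$ for all $i$. $cms_r(\mathcal{H})$ is the maximum over orderings $\ell$ of $\mathcal{H}$ of the largest $s$ such that every sequence $S$ of $s$ cyclically consecutive edges of $\ell$ has $\Delta(\mathcal{H}(S))\le r$. For orderings $\ell$ and $\ell'$ of edge sets each having at least $s-1$ edges, $\ell\vee_s\ell'$ denotes the sequence of the last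 $s-1$ edges of $\ell$ (in the order of $\ell$) followed by the first $s-1$ edges of $\ell'$ (in the order of $\ell'$); $ms(\ell,\ell')$ is the largest $s$ such that every $s$ consecutive terms of $\ell\vee_s\ell'$ form a matching (no vertex lies in two of these terms). -}

module Defs where

open import Data.Nat using (ℕ; zero; suc; _+_; _∸_; _≤_; _<_; _<?_; _⊔_; s≤s)
open import Data.Fin using (Fin; zero; suc; toℕ; fromℕ<)
open import Data.Bool using (Bool; true; false; if_then_else_)
open import Data.Nat.ListAction using (sum)
open import Data.List using (List; map; allFin; foldr; length; take; drop; tabulate; lookup; _++_)
open import Data.Product using (Σ; _×_; _,_; ∃)
open import Data.Empty using (⊥)
open import Relation.Nullary using (yes; no; ¬_)
open import Relation.Binary.PropositionalEquality using (_≡_; _≢_)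
open import Function.Bundles using (_↔_; Inverse)

-- A hypergraph with vertex set [nV] and edge set [nE]; edge e contains
-- vertex v iff inc e v ≡ true.  Parallel edges are allowed (different edge
-- indices may have the same vertex set).
record Hypergraph : Set where
  field
    nV  : ℕ
    nE  : ℕ
    inc : Fin nE → Fin nV → Bool
open Hypergraph public

deg : (H : Hypergraph) → Fin (nV H) → ℕ
deg H v = sum (map (λ e → if inc H e v then 1 else 0) (allFin (nE H)))

Δ : Hypergraph → ℕ
Δ H = foldr _⊔_ 0 (map (deg H) (allFin (nV H)))

Disjoint : (H : Hypergraph) → Fin (nE H) → Fin (nE H) → Set
Disjoint H e e' = ∀ v → inc H e v ≡ true → inc H e' v ≡ true → ⊥

IsMatching : (H : Hypergraph) {k : ℕ} → (Fin k → Fin (nE H)) → Set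
IsMatching H f = ∀ a b → a ≢ b → Disjoint H (f a) (f b)

csuc : ∀ {m} → Fin m → Fin m
csuc {suc k} i with toℕ i <? k
... | yes p = fromℕ< (s≤s p)
... | no _  = zero

shift : ∀ {m} → Fin m → ℕ → Fin m
shift p zero    = p
shift p (suc t) = csuc (shift p t)

Ordering : Hypergraph → Set
Ordering H = Fin (nE H) ↔ Fin (nE H)

seqHypergraph : (H : Hypergraph) {s : ℕ} → (Fin s → Fin (nE H)) → Hypergraph
seqHypergraph H {s} S = record { nV = nV H ; nE = s ; inc = λ i → inc H (S i) }

-- the sequence of s cyclically consecutive edges of ℓ whose first term is at
-- position p, i.e. ℓ(e_i) ≡ p + i (mod ε)
cycSeq : (H : Hypergraph) (ℓ : Ordering H) (p : Fin (nE H)) (s : ℕ) → Fin s → Fin (nE H)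
cycSeq H ℓ p s i = Inverse.from ℓ (shift p (toℕ i))

CycGood : ℕ → (H : Hypergraph) → Ordering H → ℕ → Set
CycGood r H ℓ s = ∀ (p : Fin (nE H)) → Δ (seqHypergraph H (cycSeq H ℓ p s)) ≤ r

-- cms_r(H) ≥ K : the maximum over orderings ℓ of the largest good s is ≥ K,
-- i.e. some ordering ℓ has some good s with K ≤ s.
cmsAtLeast : ℕ → Hypergraph → ℕ → Set
cmsAtLeast r H K = ∃ λ (ℓ : Ordering H) → ∃ λ s → K ≤ s × CycGood r H ℓ s

-- For orderings of n-edge sets given by their inverses f, g : [n] → edges
-- (f k = the edge at position k), ℓ ∨_s ℓ' as a list.
joinSeq : (H : Hypergraph) {n : ℕ} → (Fin n → Fin (nE H)) → (Fin n → Fin (nE H)) → ℕ → List (Fin (nE H))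
joinSeq H {n} f g s = drop (n ∸ (s ∸ 1)) (tabulate f) ++ take (s ∸ 1) (tabulate g)

-- every s consecutive terms of ℓ ∨_s ℓ' form a matching (s ≤ n+1 so that
-- both orderings have at least s-1 edges)
MsGood : (H : Hypergraph) {n : ℕ} → (Fin n → Fin (nE H)) → (Fin n → Fin (nE H)) → ℕ → Set
MsGood H {n} f g s =
  s ≤ suc n ×
  (∀ t → t + s ≤ length (joinSeq H f g s) →
     IsMatching H (lookup (take s (drop t (joinSeq H f g s)))))

msAtLeast : (H : Hypergraph) {n : ℕ} → (Fin n → Fin (nE H)) → (Fin n → Fin (nE H)) → ℕ → Set
msAtLeast H f g K = ∃ λ s → K ≤ s × MsGood H f g s

module Submission where

-- Write r = r′ d; since gcd (d c) r = d, r′ is invertible modulo c, say w r′ ≡ 1 (mod c).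
-- Cut the cyclic ordering into blocks of n positions and put into block B the matching
-- M_{i,j} with i = B mod d and j = (B div d) w mod c, in its order ℓ_{i,j}; this uses every
-- label once per c d blocks, and moving r blocks ahead keeps i and advances j by one.
-- A window of r n − x consecutive positions meets only the blocks B₀, …, B₀ + r.  A vertex
-- lies on at most one edge of each block, and not on edges of both B₀ and B₀ + r: those
-- blocks carry M_{i,j} and M_{i,j+1}, and two of their edges inside the window are fewer
-- than n − x ≤ ms(ℓ_{i,j}, ℓ_{i,j+1}) places apart in ℓ_{i,j} ∨ ℓ_{i,j+1}.  Colouring the
-- edges at a vertex by their block number modulo r therefore shows that the vertex has
-- degree at most r in the window.

open import Defs
open import Data.Bool using (Bool; true; false; if_then_else_)
open import Data.Empty using (⊥; ⊥-elim)
open import Data.Fin as Fin using (Fin; zero; suc; toℕ; fromℕ<; punchOut)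
open import Data.Fin.Permutation using (↔⇒≡)
import Data.Fin.Properties as Finₚ
open import Data.List using (List; []; _∷_; map; allFin; tabulate; length; lookup; take; drop; _++_)
open import Data.List.Properties
  using (map-tabulate; foldr-preservesᵇ; length-tabulate; length-take; length-drop; length-++)
open import Data.List.Relation.Unary.All using (universal)
open import Data.List.Relation.Unary.All.Properties using (map⁺)
open import Data.Nat using (ℕ; zero; suc; _+_; _*_; _∸_; _≤_; _<_; _⊓_; _<?_; z≤n; s≤s; NonZero; >-nonZero)
open import Data.Nat.Coprimality using (gcd≡1⇒coprime; coprime-Bézout)
open import Data.Nat.Divisibility using (_∣_; divides)
open import Data.Nat.DivMod
open import Data.Nat.GCD using (gcd; gcd-identityˡ; gcd[m,n]∣n; gcd[cm,cn]/c≡gcd[m,n]; module Bézout)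
open import Data.Nat.ListAction using (sum)
open import Data.Nat.Properties
open import Algebra.Properties.CommutativeSemigroup +-commutativeSemigroup using (xy∙z≈xz∙y)
open import Data.Nat.Tactic.RingSolver using (solve; solve-∀)
open import Data.Product using (_×_; _,_; ∃; ∃₂; proj₁; proj₂)
open import Data.Sum using (_⊎_; inj₁; inj₂)
open import Function using (_∘_)
open import Function.Bundles using (_↔_; Inverse; mk↔ₛ′)
open import Function.Properties.Inverse using (↔-refl; ↔-sym; ↔-trans)
open import Relation.Nullary using (yes; no)
open import Relation.Binary.PropositionalEquality

-- Remainders

toℕ-mod : ∀ a m .{{_ : NonZero m}} → toℕ (a mod m) ≡ a % m
toℕ-mod a m = Finₚ.toℕ-fromℕ< (m%n<n a m)

mod≡⇒%≡ : ∀ {a b} m .{{_ : NonZero m}} → a mod m ≡ b mod m → a % m ≡ b % m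
mod≡⇒%≡ {a} {b} m e = trans (sym (toℕ-mod a m)) (trans (cong toℕ e) (toℕ-mod b m))

%≡⇒mod≡ : ∀ {a b} m .{{_ : NonZero m}} → a % m ≡ b % m → a mod m ≡ b mod m
%≡⇒mod≡ {a} {b} m e = Finₚ.toℕ-injective (trans (toℕ-mod a m) (trans e (sym (toℕ-mod b m))))

[o+k*m]%m≡o : ∀ o k m .{{_ : NonZero m}} → o < m → (o + k * m) % m ≡ o
[o+k*m]%m≡o o k m o<m = trans ([m+kn]%n≡m%n o k m) (m<n⇒m%n≡m o<m)

[o+k*m]/m≡k : ∀ o k m .{{_ : NonZero m}} → o < m → (o + k * m) / m ≡ k
[o+k*m]/m≡k o k m o<m = trans (+-distrib-/-∣ʳ o (divides k refl)) (cong₂ _+_ (m<n⇒m/n≡0 o<m) (m*n/n≡m k m))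

[m%n*o]%n≡[m*o]%n : ∀ m n o .{{_ : NonZero n}} → (m % n * o) % n ≡ (m * o) % n
[m%n*o]%n≡[m*o]%n m n o = begin
  (m % n * o) % n            ≡⟨ %-distribˡ-* (m % n) o n ⟩
  (m % n % n * (o % n)) % n  ≡⟨ cong (λ z → (z * (o % n)) % n) (m%n%n≡m%n m n) ⟩
  (m % n * (o % n)) % n      ≡⟨ %-distribˡ-* m o n ⟨
  (m * o) % n                ∎
  where open ≡-Reasoning

suc[m%n]%n≡suc[m]%n : ∀ m n .{{_ : NonZero n}} → suc (m % n) % n ≡ suc m % n
suc[m%n]%n≡suc[m]%n m n = begin
  (1 + m % n) % n            ≡⟨ %-distribˡ-+ 1 (m % n) n ⟩
  (1 % n + m % n % n) % n    ≡⟨ cong (λ z → (1 % n + z) % n) (m%n%n≡m%n m n) ⟩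
  (1 % n + m % n) % n        ≡⟨ %-distribˡ-+ 1 m n ⟨
  (1 + m) % n                ∎
  where open ≡-Reasoning

%-collision : ∀ {a b r} .{{_ : NonZero r}} → a ≤ r → b ≤ r → a % r ≡ b % r →
  a ≡ b ⊎ (a ≡ 0 × b ≡ r) ⊎ (a ≡ r × b ≡ 0)
%-collision {a} {b} {r} a≤r b≤r a≡b with m≤n⇒m<n∨m≡n a≤r | m≤n⇒m<n∨m≡n b≤r
... | inj₁ a<r  | inj₁ b<r  = inj₁ (trans (sym (m<n⇒m%n≡m a<r)) (trans a≡b (m<n⇒m%n≡m b<r)))
... | inj₂ refl | inj₂ refl = inj₁ refl
... | inj₁ a<r  | inj₂ refl = inj₂ (inj₁ (trans (sym (m<n⇒m%n≡m a<r)) (trans a≡b (n%n≡0 r)) , refl))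
... | inj₂ refl | inj₁ b<r  = inj₂ (inj₂ (refl , trans (sym (m<n⇒m%n≡m b<r)) (trans (sym a≡b) (n%n≡0 r))))

toℕ-csuc : ∀ {m} .{{_ : NonZero m}} (i : Fin m) → toℕ (csuc i) ≡ suc (toℕ i) % m
toℕ-csuc {suc m} i with toℕ i <? m
... | yes i<m = trans (Finₚ.toℕ-fromℕ< (s≤s i<m)) (sym (m<n⇒m%n≡m (s≤s i<m)))
... | no i≮m  = sym (trans (cong (λ z → suc z % suc m) (≤-antisym (≤-pred (Finₚ.toℕ<n i)) (≮⇒≥ i≮m)))
                           (n%n≡0 (suc m)))

toℕ-shift : ∀ {m} .{{_ : NonZero m}} (p : Fin m) t → toℕ (shift p t) ≡ (toℕ p + t) % m
toℕ-shift {suc m} p zero    = sym (trans (cong (_% suc m) (+-identityʳ (toℕ p))) (m<n⇒m%n≡m (Finₚ.toℕ<n p)))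
toℕ-shift {suc m} p (suc t) = begin
  toℕ (csuc (shift p t))            ≡⟨ toℕ-csuc (shift p t) ⟩
  suc (toℕ (shift p t)) % suc m     ≡⟨ cong (λ z → suc z % suc m) (toℕ-shift p t) ⟩
  suc ((toℕ p + t) % suc m) % suc m ≡⟨ suc[m%n]%n≡suc[m]%n (toℕ p + t) (suc m) ⟩
  suc (toℕ p + t) % suc m           ≡⟨ cong (_% suc m) (+-suc (toℕ p) t) ⟨
  (toℕ p + suc t) % suc m           ∎
  where open ≡-Reasoning

-- Inverting r / d modulo c

gcd[d*c,r]≡d⇒coprime : ∀ d c {r} .{{_ : NonZero d}} → 0 < r → gcd (d * c) r ≡ d →
  ∃ λ r′ → 0 < r′ × r ≡ r′ * d × gcd c r′ ≡ 1
gcd[d*c,r]≡d⇒coprime d c {r} 0<r gcd≡d with subst (_∣ r) gcd≡d (gcd[m,n]∣n (d * c) r)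
... | divides r′ r≡r′*d = r′ , 0<r′ , r≡r′*d , (begin
  gcd c r′                  ≡⟨ gcd[cm,cn]/c≡gcd[m,n] d c r′ ⟨
  gcd (d * c) (d * r′) / d  ≡⟨ cong (λ z → gcd (d * c) z / d) (trans (*-comm d r′) (sym r≡r′*d)) ⟩
  gcd (d * c) r / d         ≡⟨ cong (_/ d) gcd≡d ⟩
  d / d                     ≡⟨ n/n≡1 d ⟩
  1                         ∎)
  where
  open ≡-Reasoning
  0<r′ : 0 < r′
  0<r′ = n≢0⇒n>0 (λ r′≡0 → n>0⇒n≢0 0<r (trans r≡r′*d (cong (_* d) r′≡0)))

-- In the second Bézout case w r′ ≡ −1 (mod c), so w (c − 1) is the inverse.
coprime⇒inverse : ∀ c r′ .{{_ : NonZero c}} → 0 < r′ → gcd c r′ ≡ 1 → ∃₂ λ w k → w * r′ ≡ 1 + k * c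
coprime⇒inverse 1 (suc r″) _ _ = 1 , r″ , cong suc (trans (+-identityʳ r″) (sym (*-identityʳ r″)))
coprime⇒inverse (suc (suc c′)) r′ _ gcd≡1 with coprime-Bézout (gcd≡1⇒coprime gcd≡1)
... | Bézout.-+ k w 1+k*c≡w*r′ = w , k , sym 1+k*c≡w*r′
... | Bézout.+- (suc k) w 1+w*r′≡[1+k]*c =
  w * (1 + c′) , c′ + k * (1 + c′) , +-cancelˡ-≡ (1 + c′) _ _ (begin
    (1 + c′) + w * (1 + c′) * r′                    ≡⟨ solve (c′ ∷ w ∷ r′ ∷ []) ⟩
    (1 + c′) * (1 + w * r′)                         ≡⟨ cong ((1 + c′) *_) 1+w*r′≡[1+k]*c ⟩
    (1 + c′) * (suc k * (2 + c′))                   ≡⟨ solve (c′ ∷ k ∷ []) ⟩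
    (1 + c′) + (1 + (c′ + k * (1 + c′)) * (2 + c′)) ∎)
  where open ≡-Reasoning

-- Counting incidences

count-≤-injection : ∀ {s r} (P : Fin s → Bool) (f : ∀ i → P i ≡ true → Fin r) →
  (∀ {i j} pᵢ pⱼ → f i pᵢ ≡ f j pⱼ → i ≡ j) →
  sum (tabulate (λ i → if P i then 1 else 0)) ≤ r
count-≤-injection {zero}  P f f-inj = z≤n
count-≤-injection {suc s} P f f-inj with P zero in p₀
... | false = count-≤-injection (P ∘ suc) (f ∘ suc) (λ pᵢ pⱼ → Finₚ.suc-injective ∘ f-inj pᵢ pⱼ)
... | true  = go (f zero p₀) (f ∘ suc) (λ p → Finₚ.0≢1+n ∘ f-inj p₀ p)
                 (λ pᵢ pⱼ → Finₚ.suc-injective ∘ f-inj pᵢ pⱼ)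
  where
  go : ∀ {r} (f₀ : Fin r) (g : ∀ i → P (suc i) ≡ true → Fin r) →
       (∀ {i} p → f₀ ≢ g i p) → (∀ {i j} pᵢ pⱼ → g i pᵢ ≡ g j pⱼ → i ≡ j) →
       suc (sum (tabulate (λ i → if P (suc i) then 1 else 0))) ≤ r
  go {suc r} f₀ g g≢f₀ g-inj = s≤s (count-≤-injection (P ∘ suc) (λ i p → punchOut (g≢f₀ p))
    (λ pᵢ pⱼ → g-inj pᵢ pⱼ ∘ Finₚ.punchOut-injective (g≢f₀ pᵢ) (g≢f₀ pⱼ)))

count-≤-levels : ∀ {s r} .{{_ : NonZero r}} (P : Fin s → Bool) (level : Fin s → ℕ) →
  (∀ i → level i ≤ r) →
  (∀ i j → i ≢ j → level i ≡ level j → P i ≡ true → P j ≡ true → ⊥) →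
  (∀ i j → level i ≡ 0 → level j ≡ r → P i ≡ true → P j ≡ true → ⊥) →
  sum (map (λ i → if P i then 1 else 0) (allFin s)) ≤ r
count-≤-levels {s} {r} P level level≤r one-per-level not-first-and-last
  rewrite map-tabulate {n = s} (λ i → i) (λ i → if P i then 1 else 0) =
  count-≤-injection P (λ i _ → level i mod r) colour-injective
  where
  colour-injective : ∀ {i j} → P i ≡ true → P j ≡ true → level i mod r ≡ level j mod r → i ≡ j
  colour-injective {i} {j} pᵢ pⱼ e with i Finₚ.≟ j
  ... | yes i≡j = i≡j
  ... | no i≢j with %-collision (level≤r i) (level≤r j) (mod≡⇒%≡ r e)
  ...   | inj₁ same-level         = ⊥-elim (one-per-level i j i≢j same-level pᵢ pⱼ)
  ...   | inj₂ (inj₁ (fst , lst)) = ⊥-elim (not-first-and-last i j fst lst pᵢ pⱼ)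
  ...   | inj₂ (inj₂ (lst , fst)) = ⊥-elim (not-first-and-last j i fst lst pⱼ pᵢ)

Δ≤ : ∀ (H : Hypergraph) {r} → (∀ v → deg H v ≤ r) → Δ H ≤ r
Δ≤ H {r} deg≤r = foldr-preservesᵇ {P = _≤ r} ⊔-lub z≤n (map⁺ (universal deg≤r (allFin (nV H))))

-- Windows of ℓ ∨ₛ ℓ′

infix 4 _[_]=_

data _[_]=_ {A : Set} : List A → ℕ → A → Set where
  here  : ∀ {x xs} → x ∷ xs [ 0 ]= x
  there : ∀ {x xs k y} → xs [ k ]= y → x ∷ xs [ suc k ]= y

module _ {A : Set} where

  index : ∀ {xs : List A} {k y} → xs [ k ]= y → Fin (length xs)
  index here            = zero
  index (there xs[k]=y) = suc (index xs[k]=y)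

  toℕ-index : ∀ {xs : List A} {k y} (xs[k]=y : xs [ k ]= y) → toℕ (index xs[k]=y) ≡ k
  toℕ-index here            = refl
  toℕ-index (there xs[k]=y) = cong suc (toℕ-index xs[k]=y)

  lookup-index : ∀ {xs : List A} {k y} (xs[k]=y : xs [ k ]= y) → lookup xs (index xs[k]=y) ≡ y
  lookup-index here            = refl
  lookup-index (there xs[k]=y) = lookup-index xs[k]=y

  drop-[]= : ∀ m {xs : List A} {k y} → xs [ m + k ]= y → drop m xs [ k ]= y
  drop-[]= zero    xs[k]=y         = xs[k]=y
  drop-[]= (suc m) (there xs[k]=y) = drop-[]= m xs[k]=y

  take-[]= : ∀ m {xs : List A} {k y} → xs [ k ]= y → k < m → take m xs [ k ]= y
  take-[]= (suc m) here            _         = here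
  take-[]= (suc m) (there xs[k]=y) (s≤s k<m) = there (take-[]= m xs[k]=y k<m)

  ++ˡ-[]= : ∀ {xs ys : List A} {k y} → xs [ k ]= y → xs ++ ys [ k ]= y
  ++ˡ-[]= here            = here
  ++ˡ-[]= (there xs[k]=y) = there (++ˡ-[]= xs[k]=y)

  ++ʳ-[]= : ∀ (xs : List A) {ys : List A} {k y} → ys [ k ]= y → xs ++ ys [ length xs + k ]= y
  ++ʳ-[]= []       ys[k]=y = ys[k]=y
  ++ʳ-[]= (x ∷ xs) ys[k]=y = there (++ʳ-[]= xs ys[k]=y)

  tabulate-[]= : ∀ {n} (f : Fin n → A) i → tabulate f [ toℕ i ]= f i
  tabulate-[]= f zero    = here
  tabulate-[]= f (suc i) = there (tabulate-[]= (f ∘ suc) i)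

window-disjoint : ∀ (H : Hypergraph) {L : List (Fin (nE H))} {s a b e e′} →
  (∀ t → t + s ≤ length L → IsMatching H (lookup (take s (drop t L)))) →
  L [ a ]= e → L [ b ]= e′ → a < b → b < a + s → a + s ≤ length L → Disjoint H e e′
window-disjoint H {L} {s} {a} {b} {e} {e′} windows L[a]=e L[b]=e′ a<b b<a+s a+s≤∣L∣ =
  subst₂ (Disjoint H) (lookup-index first) (lookup-index second)
    (windows a a+s≤∣L∣ (index first) (index second) indices-differ)
  where
  a+[b∸a]≡b : a + (b ∸ a) ≡ b
  a+[b∸a]≡b = m+[n∸m]≡n (<⇒≤ a<b)
  b∸a<s : b ∸ a < s
  b∸a<s = +-cancelˡ-< a (b ∸ a) s (subst (_< a + s) (sym a+[b∸a]≡b) b<a+s)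
  first : take s (drop a L) [ 0 ]= e
  first = take-[]= s (drop-[]= a (subst (L [_]= e) (sym (+-identityʳ a)) L[a]=e)) (≤-<-trans z≤n b∸a<s)
  second : take s (drop a L) [ b ∸ a ]= e′
  second = take-[]= s (drop-[]= a (subst (L [_]= e′) (sym a+[b∸a]≡b) L[b]=e′)) b∸a<s
  indices-differ : index first ≢ index second
  indices-differ same = m<n⇒n≢0 (m<n⇒0<n∸m a<b)
    (trans (sym (toℕ-index second)) (trans (cong toℕ (sym same)) (toℕ-index first)))

module _ (H : Hypergraph) {n} (f g : Fin n → Fin (nE H)) {S} (S≤n : S ≤ n) where

  length-drop-tabulate : length (drop (n ∸ S) (tabulate f)) ≡ S
  length-drop-tabulate = trans (length-drop (n ∸ S) (tabulate f))
    (trans (cong (_∸ (n ∸ S)) (length-tabulate f)) (m∸[m∸n]≡n S≤n))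

  length-joinSeq : length (joinSeq H f g (suc S)) ≡ S + S
  length-joinSeq = trans (length-++ (drop (n ∸ S) (tabulate f))) (cong₂ _+_ length-drop-tabulate
    (trans (length-take S (tabulate g)) (trans (cong (S ⊓_) (length-tabulate g)) (m≤n⇒m⊓n≡m S≤n))))

  joinSeq-[]=ˡ : ∀ {t} o → n ∸ S + t ≡ toℕ o → joinSeq H f g (suc S) [ t ]= f o
  joinSeq-[]=ˡ o n∸S+t≡o =
    ++ˡ-[]= (drop-[]= (n ∸ S) (subst (tabulate f [_]= f o) (sym n∸S+t≡o) (tabulate-[]= f o)))

  joinSeq-[]=ʳ : ∀ o → toℕ o < S → joinSeq H f g (suc S) [ S + toℕ o ]= g o
  joinSeq-[]=ʳ o o<S = subst (λ k → joinSeq H f g (suc S) [ k + toℕ o ]= g o) length-drop-tabulate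
    (++ʳ-[]= (drop (n ∸ S) (tabulate f)) (take-[]= S (tabulate-[]= g o) o<S))

ms-disjoint : ∀ (H : Hypergraph) {n s} (f g : Fin n → Fin (nE H)) → MsGood H f g s →
  ∀ o₁ o₂ → n + toℕ o₂ < toℕ o₁ + s → Disjoint H (f o₁) (g o₂)
ms-disjoint H {n} {zero} f g _ o₁ o₂ gap = ⊥-elim (<-asym (Finₚ.toℕ<n o₁)
  (≤-<-trans (m≤m+n n (toℕ o₂)) (subst (n + toℕ o₂ <_) (+-identityʳ (toℕ o₁)) gap)))
-- In ℓ ∨ₛ ℓ′, f o₁ is at index t = o₁ − (n − S) and g o₂ at index S + o₂, less than S + 1 apart.
ms-disjoint H {n} {suc S} f g (s≤s S≤n , windows) o₁ o₂ gap = window-disjoint H windows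
  (joinSeq-[]=ˡ H f g S≤n o₁ m+t≡o₁) (joinSeq-[]=ʳ H f g S≤n o₂ (≤-<-trans o₂≤t t<S))
  (<-≤-trans t<S (m≤m+n S (toℕ o₂))) S+o₂<t+1+S
  (subst (t + suc S ≤_) (sym (length-joinSeq H f g S≤n)) t+1+S≤S+S)
  where
  open ≤-Reasoning
  m = n ∸ S
  m+S≡n : m + S ≡ n
  m+S≡n = m∸n+n≡m S≤n
  gap′ : m + S + toℕ o₂ ≤ toℕ o₁ + S
  gap′ = subst (λ z → z + toℕ o₂ ≤ toℕ o₁ + S) (sym m+S≡n)
    (≤-pred (subst (n + toℕ o₂ <_) (+-suc (toℕ o₁) S) gap))
  m≤o₁ : m ≤ toℕ o₁
  m≤o₁ = +-cancelʳ-≤ S m (toℕ o₁) (≤-trans (m≤m+n (m + S) (toℕ o₂)) gap′)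
  t = toℕ o₁ ∸ m
  m+t≡o₁ : m + t ≡ toℕ o₁
  m+t≡o₁ = m+[n∸m]≡n m≤o₁
  t<S : t < S
  t<S = +-cancelˡ-< m t S
    (begin-strict m + t ≡⟨ m+t≡o₁ ⟩ toℕ o₁ <⟨ Finₚ.toℕ<n o₁ ⟩ n ≡⟨ m+S≡n ⟨ m + S ∎)
  o₂≤t : toℕ o₂ ≤ t
  o₂≤t = +-cancelˡ-≤ m (toℕ o₂) t (+-cancelʳ-≤ S (m + toℕ o₂) (m + t) (begin
    m + toℕ o₂ + S ≡⟨ xy∙z≈xz∙y m (toℕ o₂) S ⟩
    m + S + toℕ o₂ ≤⟨ gap′ ⟩
    toℕ o₁ + S     ≡⟨ cong (_+ S) m+t≡o₁ ⟨
    m + t + S      ∎))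
  S+o₂<t+1+S : S + toℕ o₂ < t + suc S
  S+o₂<t+1+S = begin-strict
    S + toℕ o₂ ≤⟨ +-monoʳ-≤ S o₂≤t ⟩
    S + t      <⟨ n<1+n (S + t) ⟩
    suc S + t  ≡⟨ +-comm (suc S) t ⟩
    t + suc S  ∎
  t+1+S≤S+S : t + suc S ≤ S + S
  t+1+S≤S+S = begin t + suc S ≡⟨ +-suc t S ⟩ suc t + S ≤⟨ +-monoˡ-≤ S t<S ⟩ S + S ∎

msAtLeast-disjoint : ∀ (H : Hypergraph) {n x} (f g : Fin n → Fin (nE H)) → msAtLeast H f g (n ∸ x) →
  ∀ o₁ o₂ → toℕ o₂ + x < toℕ o₁ → Disjoint H (f o₁) (g o₂)
msAtLeast-disjoint H {n} {x} f g (s , n∸x≤s , good) o₁ o₂ o₂+x<o₁ =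
  ms-disjoint H f g good o₁ o₂ (begin-strict
  n + toℕ o₂       ≤⟨ +-monoˡ-≤ (toℕ o₂) (≤-trans (m≤n+m∸n n x) (+-monoʳ-≤ x n∸x≤s)) ⟩
  x + s + toℕ o₂   ≡⟨ +-comm (x + s) (toℕ o₂) ⟩
  toℕ o₂ + (x + s) ≡⟨ +-assoc (toℕ o₂) x s ⟨
  toℕ o₂ + x + s   <⟨ +-monoˡ-< s o₂+x<o₁ ⟩
  toℕ o₁ + s       ∎)
  where open ≤-Reasoning

-- The ordering

module Schedule (d c n : ℕ) {{_ : NonZero d}} {{_ : NonZero c}} {{_ : NonZero n}}
                {r′ w k : ℕ} (inverse : w * r′ ≡ 1 + k * c) where

  instance
    cd≢0 : NonZero (c * d)
    cd≢0 = m*n≢0 c d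
    cdn≢0 : NonZero (c * d * n)
    cdn≢0 = m*n≢0 (c * d) n

  blockI : ℕ → Fin d
  blockI B = B mod d

  blockJ : ℕ → Fin c
  blockJ B = (B / d * w) mod c

  blockOf : Fin d → Fin c → ℕ
  blockOf i j = toℕ i + (toℕ j * r′ % c) * d

  [m*[w*r′]]%c≡m%c : ∀ m → m * (w * r′) % c ≡ m % c
  [m*[w*r′]]%c≡m%c m = begin
    m * (w * r′) % c     ≡⟨ cong (λ z → m * z % c) inverse ⟩
    m * (1 + k * c) % c  ≡⟨ cong (_% c) (solve (m ∷ k ∷ c ∷ [])) ⟩
    (m + m * k * c) % c  ≡⟨ [m+kn]%n≡m%n m (m * k) c ⟩
    m % c                ∎
    where open ≡-Reasoning

  blockOf<cd : ∀ i j → blockOf i j < c * d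
  blockOf<cd i j = begin-strict
    toℕ i + (toℕ j * r′ % c) * d <⟨ +-monoˡ-< _ (Finₚ.toℕ<n i) ⟩
    suc (toℕ j * r′ % c) * d     ≤⟨ *-monoˡ-≤ d (m%n<n (toℕ j * r′) c) ⟩
    c * d                        ∎
    where open ≤-Reasoning

  blockI-blockOf : ∀ i j → blockI (blockOf i j) ≡ i
  blockI-blockOf i j = Finₚ.toℕ-injective
    (trans (toℕ-mod _ d) ([o+k*m]%m≡o (toℕ i) (toℕ j * r′ % c) d (Finₚ.toℕ<n i)))

  blockJ-blockOf : ∀ i j → blockJ (blockOf i j) ≡ j
  blockJ-blockOf i j = Finₚ.toℕ-injective (begin
    toℕ (blockJ (blockOf i j)) ≡⟨ toℕ-mod _ c ⟩
    blockOf i j / d * w % c    ≡⟨ cong (λ z → z * w % c) ([o+k*m]/m≡k (toℕ i) (toℕ j * r′ % c) d (Finₚ.toℕ<n i)) ⟩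
    toℕ j * r′ % c * w % c     ≡⟨ [m%n*o]%n≡[m*o]%n (toℕ j * r′) c w ⟩
    toℕ j * r′ * w % c         ≡⟨ cong (_% c) (trans (*-assoc (toℕ j) r′ w) (cong (toℕ j *_) (*-comm r′ w))) ⟩
    toℕ j * (w * r′) % c       ≡⟨ [m*[w*r′]]%c≡m%c (toℕ j) ⟩
    toℕ j % c                  ≡⟨ m<n⇒m%n≡m (Finₚ.toℕ<n j) ⟩
    toℕ j                      ∎)
    where open ≡-Reasoning

  blockOf-block : ∀ B → B < c * d → blockOf (blockI B) (blockJ B) ≡ B
  blockOf-block B B<cd = begin
    toℕ (blockI B) + (toℕ (blockJ B) * r′ % c) * d
      ≡⟨ cong₂ (λ a b → a + (b * r′ % c) * d) (toℕ-mod B d) (toℕ-mod _ c) ⟩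
    B % d + (B / d * w % c * r′ % c) * d           ≡⟨ cong (λ z → B % d + z * d) column ⟩
    B % d + B / d * d                              ≡⟨ m≡m%n+[m/n]*n B d ⟨
    B                                              ∎
    where
    open ≡-Reasoning
    column : B / d * w % c * r′ % c ≡ B / d
    column = begin
      B / d * w % c * r′ % c ≡⟨ [m%n*o]%n≡[m*o]%n (B / d * w) c r′ ⟩
      B / d * w * r′ % c     ≡⟨ cong (_% c) (*-assoc (B / d) w r′) ⟩
      B / d * (w * r′) % c   ≡⟨ [m*[w*r′]]%c≡m%c (B / d) ⟩
      B / d % c              ≡⟨ m<n⇒m%n≡m (m<n*o⇒m/o<n B<cd) ⟩
      B / d                  ∎

  blockI-%cd : ∀ B → blockI (B % (c * d)) ≡ blockI B
  blockI-%cd B = %≡⇒mod≡ d (m∣n⇒o%n%m≡o%m d (c * d) B (divides c refl))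

  blockJ-%cd : ∀ B → blockJ (B % (c * d)) ≡ blockJ B
  blockJ-%cd B = %≡⇒mod≡ c
    (trans (cong (λ z → z * w % c) (m%[n*o]/o≡m/o%n B c d)) ([m%n*o]%n≡[m*o]%n (B / d) c w))

  blockI-+r : ∀ B → blockI (B + r′ * d) ≡ blockI B
  blockI-+r B = %≡⇒mod≡ d ([m+kn]%n≡m%n B r′ d)

  blockJ-+r : ∀ B → blockJ (B + r′ * d) ≡ csuc (blockJ B)
  blockJ-+r B = Finₚ.toℕ-injective (begin
    toℕ (blockJ (B + r′ * d))     ≡⟨ toℕ-mod _ c ⟩
    (B + r′ * d) / d * w % c      ≡⟨ cong (λ z → z * w % c) (+-distrib-/-∣ʳ B (divides r′ refl)) ⟩
    (B / d + r′ * d / d) * w % c  ≡⟨ cong (λ z → (B / d + z) * w % c) (m*n/n≡m r′ d) ⟩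
    (B / d + r′) * w % c          ≡⟨ cong (_% c) (trans (*-distribʳ-+ w (B / d) r′) (cong (B / d * w +_) (*-comm r′ w))) ⟩
    (B / d * w + w * r′) % c      ≡⟨ cong (λ z → (B / d * w + z) % c) inverse ⟩
    (B / d * w + (1 + k * c)) % c ≡⟨ cong (_% c) (+-suc (B / d * w) (k * c)) ⟩
    (suc (B / d * w) + k * c) % c ≡⟨ [m+kn]%n≡m%n (suc (B / d * w)) k c ⟩
    suc (B / d * w) % c           ≡⟨ suc[m%n]%n≡suc[m]%n (B / d * w) c ⟨
    suc (B / d * w % c) % c       ≡⟨ cong (λ z → suc z % c) (toℕ-mod _ c) ⟨
    suc (toℕ (blockJ B)) % c      ≡⟨ toℕ-csuc (blockJ B) ⟨
    toℕ (csuc (blockJ B))         ∎)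
    where open ≡-Reasoning

  decode : ℕ → Fin d × Fin c × Fin n
  decode q = blockI (q / n) , blockJ (q / n) , q mod n

  position : Fin d × Fin c × Fin n → ℕ
  position (i , j , o) = toℕ o + blockOf i j * n

  position<cdn : ∀ t → position t < c * d * n
  position<cdn (i , j , o) = begin-strict
    toℕ o + blockOf i j * n <⟨ +-monoˡ-< _ (Finₚ.toℕ<n o) ⟩
    suc (blockOf i j) * n   ≤⟨ *-monoˡ-≤ n (blockOf<cd i j) ⟩
    c * d * n               ∎
    where open ≤-Reasoning

  decode-position : ∀ t → decode (position t) ≡ t
  decode-position (i , j , o) rewrite [o+k*m]/m≡k (toℕ o) (blockOf i j) n (Finₚ.toℕ<n o) =
    cong₂ _,_ (blockI-blockOf i j) (cong₂ _,_ (blockJ-blockOf i j)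
      (Finₚ.toℕ-injective (trans (toℕ-mod _ n) ([o+k*m]%m≡o (toℕ o) (blockOf i j) n (Finₚ.toℕ<n o)))))

  position-decode : ∀ q → q < c * d * n → position (decode q) ≡ q
  position-decode q q<cdn = begin
    toℕ (q mod n) + blockOf (blockI (q / n)) (blockJ (q / n)) * n
      ≡⟨ cong₂ (λ a b → a + b * n) (toℕ-mod q n) (blockOf-block (q / n) (m<n*o⇒m/o<n q<cdn)) ⟩
    q % n + q / n * n
      ≡⟨ m≡m%n+[m/n]*n q n ⟨
    q ∎
    where open ≡-Reasoning

  schedule : (Fin d × Fin c × Fin n) ↔ Fin (c * d * n)
  schedule = mk↔ₛ′ (λ t → fromℕ< (position<cdn t)) (decode ∘ toℕ)
    (λ q → Finₚ.toℕ-injective (trans (Finₚ.toℕ-fromℕ< _) (position-decode (toℕ q) (Finₚ.toℕ<n q))))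
    (λ t → trans (cong decode (Finₚ.toℕ-fromℕ< (position<cdn t))) (decode-position t))

  decode-%cdn : ∀ q → decode (q % (c * d * n)) ≡ decode q
  decode-%cdn q = cong₂ _,_ (trans (cong blockI block≡) (blockI-%cd (q / n)))
    (cong₂ _,_ (trans (cong blockJ block≡) (blockJ-%cd (q / n)))
               (%≡⇒mod≡ n (m∣n⇒o%n%m≡o%m n (c * d * n) q (divides (c * d) refl))))
    where
    block≡ : q % (c * d * n) / n ≡ q / n % (c * d)
    block≡ = m%[n*o]/o≡m/o%n q (c * d) n

module Window (H : Hypergraph) {d c n : ℕ} {{_ : NonZero d}} {{_ : NonZero c}} {{_ : NonZero n}}
  (σ : (Fin d × Fin c × Fin n) ↔ Fin (nE H)) {x r′ w k : ℕ} (inverse : w * r′ ≡ 1 + k * c)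
  (matchings : ∀ i j → IsMatching H (λ o → Inverse.to σ (i , j , o)))
  (ms : ∀ i j → msAtLeast H (λ o → Inverse.to σ (i , j , o)) (λ o → Inverse.to σ (i , csuc j , o)) (n ∸ x))
  (x<n : x < n) (0<r′ : 0 < r′) where

  open Schedule d c n {r′} {w} {k} inverse

  r : ℕ
  r = r′ * d

  nE≡cdn : nE H ≡ c * d * n
  nE≡cdn = ↔⇒≡ (↔-trans (↔-sym σ) schedule)

  instance
    r≢0 : NonZero r
    r≢0 = m*n≢0 r′ d {{>-nonZero 0<r′}}
    nE≢0 : NonZero (nE H)
    nE≢0 = subst NonZero (sym nE≡cdn) cdn≢0

  ordering : Ordering H
  ordering = ↔-trans (↔-sym σ) (↔-trans schedule (mk↔ₛ′ (Fin.cast (sym nE≡cdn)) (Fin.cast nE≡cdn)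
    (Finₚ.cast-involutive (sym nE≡cdn) nE≡cdn) (Finₚ.cast-involutive nE≡cdn (sym nE≡cdn))))

  edgeAt : ℕ → Fin (nE H)
  edgeAt q = Inverse.to σ (decode q)

  cycSeq≡edgeAt : ∀ p s i → cycSeq H ordering p s i ≡ edgeAt (toℕ p + toℕ i)
  cycSeq≡edgeAt p s i = cong (Inverse.to σ) (trans (cong decode position≡) (decode-%cdn (toℕ p + toℕ i)))
    where
    position≡ : toℕ (Fin.cast nE≡cdn (shift p (toℕ i))) ≡ (toℕ p + toℕ i) % (c * d * n)
    position≡ = trans (Finₚ.toℕ-cast _ _) (trans (toℕ-shift p (toℕ i)) (%-congʳ nE≡cdn))

  same-block-disjoint : ∀ {q q′} → q / n ≡ q′ / n → q ≢ q′ → Disjoint H (edgeAt q) (edgeAt q′)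
  same-block-disjoint {q} {q′} same q≢q′ rewrite same =
    matchings (blockI (q′ / n)) (blockJ (q′ / n)) (q mod n) (q′ mod n) offsets-differ
    where
    offsets-differ : q mod n ≢ q′ mod n
    offsets-differ e = q≢q′ (begin
      q                   ≡⟨ m≡m%n+[m/n]*n q n ⟩
      q % n + q / n * n   ≡⟨ cong₂ (λ a b → a + b * n) (mod≡⇒%≡ n e) same ⟩
      q′ % n + q′ / n * n ≡⟨ m≡m%n+[m/n]*n q′ n ⟨
      q′                  ∎)
      where open ≡-Reasoning

  next-block-disjoint : ∀ {q q′} → q′ / n ≡ q / n + r → q′ + x < q + r * n →
    Disjoint H (edgeAt q) (edgeAt q′)
  next-block-disjoint {q} {q′} next q′+x<q+rn rewrite next | blockI-+r (q / n) | blockJ-+r (q / n) =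
    msAtLeast-disjoint H _ _ (ms (blockI (q / n)) (blockJ (q / n))) (q mod n) (q′ mod n)
      (subst₂ (λ a b → a + x < b) (sym (toℕ-mod q′ n)) (sym (toℕ-mod q n)) offset-gap)
    where
    open ≤-Reasoning
    rearrange : ∀ a x B r n → a + x + (B * n + r * n) ≡ a + (B + r) * n + x
    rearrange = solve-∀
    offset-gap : q′ % n + x < q % n
    offset-gap = +-cancelʳ-< (q / n * n + r * n) (q′ % n + x) (q % n) (begin-strict
      q′ % n + x + (q / n * n + r * n) ≡⟨ rearrange (q′ % n) x (q / n) r n ⟩
      q′ % n + (q / n + r) * n + x     ≡⟨ cong (λ B → q′ % n + B * n + x) next ⟨
      q′ % n + q′ / n * n + x          ≡⟨ cong (_+ x) (m≡m%n+[m/n]*n q′ n) ⟨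
      q′ + x                           <⟨ q′+x<q+rn ⟩
      q + r * n                        ≡⟨ cong (_+ r * n) (m≡m%n+[m/n]*n q n) ⟩
      q % n + q / n * n + r * n        ≡⟨ +-assoc (q % n) (q / n * n) (r * n) ⟩
      q % n + (q / n * n + r * n)      ∎)

  window-degree : ∀ p v → deg (seqHypergraph H (cycSeq H ordering p (r * n ∸ x))) v ≤ r
  window-degree p v = count-≤-levels hits level level≤r one-per-level not-first-and-last
    where
    open ≤-Reasoning
    s = r * n ∸ x
    q : Fin s → ℕ
    q i = toℕ p + toℕ i
    level : Fin s → ℕ
    level i = q i / n ∸ toℕ p / n
    hits : Fin s → Bool
    hits i = inc H (cycSeq H ordering p s i) v
    hits⇒edgeAt : ∀ i → hits i ≡ true → inc H (edgeAt (q i)) v ≡ true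
    hits⇒edgeAt i = subst (λ e → inc H e v ≡ true) (cycSeq≡edgeAt p s i)
    block≡ : ∀ i → q i / n ≡ toℕ p / n + level i
    block≡ i = sym (m+[n∸m]≡n (/-monoˡ-≤ n (m≤m+n (toℕ p) (toℕ i))))
    level≤r : ∀ i → level i ≤ r
    level≤r i = +-cancelˡ-≤ (toℕ p / n) (level i) r (begin
      toℕ p / n + level i   ≡⟨ block≡ i ⟨
      q i / n               ≤⟨ /-monoˡ-≤ n (+-monoʳ-≤ (toℕ p) (≤-trans (<⇒≤ (Finₚ.toℕ<n i)) (m∸n≤m (r * n) x))) ⟩
      (toℕ p + r * n) / n   ≡⟨ +-distrib-/-∣ʳ (toℕ p) (divides r refl) ⟩
      toℕ p / n + r * n / n ≡⟨ cong (toℕ p / n +_) (m*n/n≡m r n) ⟩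
      toℕ p / n + r         ∎)
    one-per-level : ∀ i j → i ≢ j → level i ≡ level j → hits i ≡ true → hits j ≡ true → ⊥
    one-per-level i j i≢j same-level hᵢ hⱼ =
      same-block-disjoint (trans (block≡ i) (trans (cong (toℕ p / n +_) same-level) (sym (block≡ j))))
        (i≢j ∘ Finₚ.toℕ-injective ∘ +-cancelˡ-≡ (toℕ p) _ _) v (hits⇒edgeAt i hᵢ) (hits⇒edgeAt j hⱼ)
    not-first-and-last : ∀ i j → level i ≡ 0 → level j ≡ r → hits i ≡ true → hits j ≡ true → ⊥
    not-first-and-last i j first last hᵢ hⱼ =
      next-block-disjoint blocks-apart gap v (hits⇒edgeAt i hᵢ) (hits⇒edgeAt j hⱼ)
      where
      blocks-apart : q j / n ≡ q i / n + r
      blocks-apart = begin-equality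
        q j / n               ≡⟨ block≡ j ⟩
        toℕ p / n + level j   ≡⟨ cong (toℕ p / n +_) last ⟩
        toℕ p / n + r         ≡⟨ cong (_+ r) (+-identityʳ (toℕ p / n)) ⟨
        toℕ p / n + 0 + r     ≡⟨ cong (λ z → toℕ p / n + z + r) first ⟨
        toℕ p / n + level i + r ≡⟨ cong (_+ r) (block≡ i) ⟨
        q i / n + r           ∎
      gap : q j + x < q i + r * n
      gap = begin-strict
        toℕ p + toℕ j + x   ≡⟨ +-assoc (toℕ p) (toℕ j) x ⟩
        toℕ p + (toℕ j + x) <⟨ +-monoʳ-< (toℕ p) (+-monoˡ-< x (Finₚ.toℕ<n j)) ⟩
        toℕ p + (s + x)     ≡⟨ cong (toℕ p +_) (m∸n+n≡m (≤-trans (<⇒≤ x<n) (m≤n*m n r))) ⟩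
        toℕ p + r * n       ≤⟨ +-monoˡ-≤ (r * n) (m≤m+n (toℕ p) (toℕ i)) ⟩
        q i + r * n         ∎

  cmsAtLeast-rn∸x : cmsAtLeast r H (r * n ∸ x)
  cmsAtLeast-rn∸x = ordering , r * n ∸ x , ≤-refl ,
    λ p → Δ≤ (seqHypergraph H (cycSeq H ordering p (r * n ∸ x))) (window-degree p)

proposition2p5 : (H : Hypergraph) (d c n : ℕ)
    (σ : (Fin d × Fin c × Fin n) ↔ Fin (nE H))
    (x : ℕ) (r : ℕ) →
    (∀ i j → IsMatching H (λ k → Inverse.to σ (i , j , k))) →
    x < n → 0 < r → r < Δ H →
    gcd (d * c) r ≡ d →
    (∀ i j → msAtLeast H (λ k → Inverse.to σ (i , j , k))
                         (λ k → Inverse.to σ (i , csuc j , k)) (n ∸ x)) →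
    cmsAtLeast r H (r * n ∸ x)
proposition2p5 H zero c n σ x r _ _ 0<r _ gcd≡d _ =
  ⊥-elim (m<n⇒n≢0 0<r (trans (sym (gcd-identityˡ r)) gcd≡d))
proposition2p5 H d zero n σ x r _ _ _ _ _ _ =
  ↔-refl , r * n ∸ x , ≤-refl , λ p → ⊥-elim (Finₚ.¬Fin0 (proj₁ (proj₂ (Inverse.from σ p))))
proposition2p5 H d c zero σ x r _ x<0 _ _ _ _ = ⊥-elim (n≮0 x<0)
proposition2p5 H d@(suc _) c@(suc _) n@(suc _) σ x r matchings x<n 0<r _ gcd≡d ms =
  let r′ , 0<r′ , r≡r′*d , coprime = gcd[d*c,r]≡d⇒coprime d c 0<r gcd≡d
      w , k , inverse = coprime⇒inverse c r′ 0<r′ coprime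
  in subst (λ r → cmsAtLeast r H (r * n ∸ x)) (sym r≡r′*d)
       (Window.cmsAtLeast-rn∸x H σ {x} {r′} {w} {k} inverse matchings ms x<n 0<r′)
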